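{- Let $r\geq 1$ and let $n$ be a positive integer. Then: (i) The sets $P^i_r(n)$, $1\leq i\leq r$, are pairwise disjoint and their union is $P_r(n)$. (ii) For each $1\leq i\leq r$, the map \[(S_1,\dots,S_r)\mapsto (S_1+i,\,\dots,\,S_{i-1}+i,\,\{0\}\cup(S_i+i),\,S_{i+1}+i,\,\dots,\,S_r+i)\] (only the $i$-th entry receives the extra element $0$) is a well-defined bijection from $P_r(n-i)$ onto $P^i_r(n)$. (iii) For all $r>0$ and all $n\in\mathbb{Z}$ we have $|P_r(n)|=F^{(r)}_n$.
   Context: For a set $S\subset\mathbb{Z}$ and $j\in\mathbb{Z}$, $S+j:=\{s+j:s\in S\}$. For $r\in\mathbb{N}$ and a positive integer $n$, $P_r(n)$ is the set of $r$-tuples $(S_1,\dots,S_r)$ of subsets $S_i\subset\{0,1,\dots,n-1\}$ such that the sets $\{S_i+j: 1\leq i\leq r,\ 0\leq j\leq i-1\}$ form a partition of $\{0,1,\dots,n-1\}$ (i.e. they are pairwise disjoint, as indexed sets, and their union is $\{0,\dots,n-1\}$). Also $P_r(0)$ consists of a single element, the tuple of empty sets $(\emptyset,\dots,\emptyset)$, and $P_r(-n)=\emptyset$ for $n>0$. For $1\leq i\leq r$, $P^i_r(n):=\{(S_1,\dots,S_r)\in P_r(n): 0\in S_i\}$. The $r$-step Fibonacci numbers are defined by $F^{(r)}_{ -n}=0$ for $n>0$, $F^{(r)}_0=1$, and $F^{(r)}_n=\sum_{i=n-r}^{n-1}F^{(r)}_i$ for $n>0$. -}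

module Defs where

open import Data.Bool using (Bool; true; false)
open import Data.Nat using (ℕ; zero; suc; _+_; _≤_; _<_)
open import Data.Integer using (ℤ; +_; -[1+_])
open import Data.Fin using (Fin; toℕ)
open import Data.Fin.Subset using (Subset; outside; inside; ⁅_⁆; _∪_)
open import Data.Vec using (Vec; []; _∷_; replicate; _++_; lookup; map; updateAt)
open import Data.List using (List; []; _∷_; take; length)
open import Data.Nat.ListAction using (sum)
open import Data.List.Membership.Propositional using () renaming (_∈_ to _∈ₗ_)
open import Data.List.Relation.Unary.Unique.Propositional using (Unique)
open import Data.Product using (Σ; _×_; _,_)
open import Data.Empty using (⊥)
open import Function.Bundles using (_⇔_)
open import Relation.Binary.PropositionalEquality using (_≡_; _≢_)

-- A subset of {0,…,n-1} is a characteristic vector 'Subset n = Vec Bool n'.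
-- Membership of a natural number x in such a subset (x ∈ S iff x < n and the
-- x-th bit is 'inside').
data _∈ᴺ_ : {n : ℕ} → ℕ → Subset n → Set where
  here  : ∀ {n} {S : Subset n} → zero ∈ᴺ (inside ∷ S)
  there : ∀ {n} {b} {S : Subset n} {x} → x ∈ᴺ S → suc x ∈ᴺ (b ∷ S)

_∈_+_ : {n : ℕ} → ℕ → Subset n → ℕ → Set
x ∈ S + j = Σ ℕ λ s → s ∈ᴺ S × x ≡ s + j

-- An r-tuple (S_1,…,S_r) of subsets of {0,…,n-1}; the paper's index i
-- corresponds to k : Fin r with i = suc (toℕ k), so the admissible shifts
-- 0 ≤ j ≤ i-1 are exactly j ≤ toℕ k.
Tuple : ℕ → ℕ → Set
Tuple r n = Vec (Subset n) r

record IsPart (r n : ℕ) (S : Tuple r n) : Set where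
  field
    disjoint : ∀ (k k' : Fin r) (j j' : ℕ) → j ≤ toℕ k → j' ≤ toℕ k' →
               (k , j) ≢ (k' , j') →
               ∀ x → x ∈ lookup S k + j → x ∈ lookup S k' + j' → ⊥
    union    : ∀ x → (x < n) ⇔ (Σ (Fin r) λ k → Σ ℕ λ j → j ≤ toℕ k × x ∈ lookup S k + j)

-- P^i_r(n) membership (i = suc (toℕ k)): 0 ∈ S_i.
IsPartAt : (r n : ℕ) → Fin r → Tuple r n → Set
IsPartAt r n k S = IsPart r n S × zero ∈ᴺ lookup S k

shift : {m : ℕ} (i : ℕ) → Subset m → Subset (i + m)
shift i S = replicate i outside ++ S

φ : {r m : ℕ} (k : Fin r) → Tuple r m → Tuple r (suc (toℕ k) + m)
φ k S = updateAt (map (shift (suc (toℕ k))) S) k (λ T → ⁅ Fin.zero ⁆ ∪ T)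

-- P_r(n) for integer n: tuples of subsets of {0,…,n-1} for n ≥ 0; empty
-- carrier for n < 0.
TupleZ : ℕ → ℤ → Set
TupleZ r (+ n)     = Tuple r n
TupleZ r -[1+ n ]  = ⊥

IsPartZ : (r : ℕ) (z : ℤ) → TupleZ r z → Set
IsPartZ r (+ n) S = IsPart r n S
IsPartZ r -[1+ n ] ()

HasCard : {A : Set} → (A → Set) → ℕ → Set
HasCard {A} P c = Σ (List A) λ L → Unique L × (∀ a → (a ∈ₗ L) ⇔ P a) × length L ≡ c

-- r-step Fibonacci numbers.  fibList r n = [F_n, F_{n-1}, …, F_0];
-- F_{n+1} = F_n + … + F_{n+1-r} (terms with negative index are 0, i.e. absent).
fibList : ℕ → ℕ → List ℕ
fibList r zero    = 1 ∷ []
fibList r (suc n) = sum (take r (fibList r n)) ∷ fibList r n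

fib : ℕ → ℕ → ℕ
fib r n with fibList r n
... | []    = 0
... | x ∷ _ = x

fibZ : ℕ → ℤ → ℕ
fibZ r (+ n)    = fib r n
fibZ r -[1+ n ] = 0

module Submission where

-- In a partition (S₁,…,S_r) ∈ P_r(n) with n ≥ 1 the point 0 is covered by
-- exactly one block S_i + 0, i.e. 0 ∈ S_i for exactly one i; this is (i).  If
-- 0 ∈ S_i then S_i + 0, …, S_i + (i-1) cover {0,…,i-1}, so no other block meets
-- that range; removing it and shifting everything down by i gives a partition
-- of {0,…,n-i-1}, and φ_i is the inverse of this operation; this is (ii).
-- Counting both sides of (i) and (ii) gives |P_r(n)| = Σ_i |P_r(n-i)|, which is
-- the Fibonacci recurrence; this is (iii), by strong induction on n.

open import Defs
open import Data.Nat using (ℕ; zero; suc; _+_; _≤_; _<_; _∸_; z≤n; s≤s; z<s; s<s; _≤?_; _≟_)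
open import Data.Nat.Properties
  using (+-assoc; +-identityʳ; +-cancelˡ-≡; +-cancelˡ-<; +-monoʳ-<; m≤m+n; ≤-trans; ≤-refl;
         ≤-reflexive; ≤-pred; 1+n≰n; ≰⇒>; m+[n∸m]≡n; m∸n≤m)
open import Data.Nat.Induction using (<-rec)
open import Data.Integer using (ℤ; -[1+_]) renaming (+_ to pos)
open import Data.Fin using (Fin; toℕ; zero; suc)
import Data.Fin as Fin
open import Data.Fin.Properties using (suc-injective)
open import Data.Fin.Subset using (Subset; outside; inside; ⁅_⁆; _∪_)
open import Data.Fin.Subset.Properties using (∪-identityˡ)
open import Data.Vec using (Vec; []; _∷_; lookup; map; replicate)
open import Data.Vec.Properties using (lookup∘updateAt; lookup∘updateAt′; lookup-map)
open import Data.List using (List; []; _∷_; take; tabulate; _++_) renaming (map to mapₗ)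
open import Data.List.Properties using (length-++; length-map; take-[])
open import Data.Nat.ListAction using (sum)
open import Data.List.Membership.Propositional using () renaming (_∈_ to _∈ₗ_)
open import Data.List.Membership.Propositional.Properties using (∈-map⁻; ∈-map⁺; ∈-++⁻; ∈-++⁺ˡ; ∈-++⁺ʳ)
open import Data.List.Relation.Unary.Any using (here)
open import Data.List.Relation.Unary.All using ([])
open import Data.List.Relation.Unary.AllPairs using ([]; _∷_)
open import Data.List.Relation.Unary.Unique.Propositional.Properties using (map⁺; ++⁺)
open import Data.Product using (Σ; _×_; _,_; proj₁; proj₂)
open import Data.Product.Properties using (≡-dec)
open import Data.Sum using (_⊎_; inj₁; inj₂)
import Data.Sum as Sum
open import Data.Empty using (⊥; ⊥-elim)
open import Relation.Nullary using (yes; no; ¬_)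
open import Relation.Binary.PropositionalEquality
open import Function using (_∘_)
open import Function.Bundles using (_⇔_; mk⇔; Equivalence)
open Equivalence using (to; from)

subset-ext : ∀ {n} (S S' : Subset n) →
             (∀ x → x ∈ᴺ S → x ∈ᴺ S') → (∀ x → x ∈ᴺ S' → x ∈ᴺ S) → S ≡ S'
subset-ext []      []        _ _ = refl
subset-ext (b ∷ S) (b' ∷ S') f g =
  cong₂ _∷_ (head-bit b b' (f zero) (g zero)) (subset-ext S S' (tail f) (tail g))
  where
  tail : ∀ {b b'} {U V : Subset _} → (∀ x → x ∈ᴺ (b ∷ U) → x ∈ᴺ (b' ∷ V)) → ∀ x → x ∈ᴺ U → x ∈ᴺ V
  tail h x p with h (suc x) (there p)
  ... | there q = q
  head-bit : ∀ b b' → (zero ∈ᴺ (b ∷ S) → zero ∈ᴺ (b' ∷ S')) →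
             (zero ∈ᴺ (b' ∷ S') → zero ∈ᴺ (b ∷ S)) → b ≡ b'
  head-bit inside  inside  _ _ = refl
  head-bit outside outside _ _ = refl
  head-bit inside  outside f' _ with f' here
  ... | ()
  head-bit outside inside  _ g' with g' here
  ... | ()

tuple-ext : ∀ {A : Set} {r} (xs ys : Vec A r) → (∀ l → lookup xs l ≡ lookup ys l) → xs ≡ ys
tuple-ext []       []       _ = refl
tuple-ext (x ∷ xs) (y ∷ ys) f = cong₂ _∷_ (f zero) (tuple-ext xs ys (λ l → f (suc l)))

below-or-shifted : ∀ i x → x < i ⊎ Σ ℕ λ y → x ≡ i + y
below-or-shifted zero    x       = inj₂ (x , refl)
below-or-shifted (suc i) zero    = inj₁ z<s
below-or-shifted (suc i) (suc x) = Sum.map s<s (λ (y , e) → y , cong suc e) (below-or-shifted i x)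

shift⁺ : ∀ {m} i {S : Subset m} {y} → y ∈ᴺ S → (i + y) ∈ᴺ shift i S
shift⁺ zero    p = p
shift⁺ (suc i) p = there (shift⁺ i p)

shift⁻ : ∀ {m} i {S : Subset m} {x} → x ∈ᴺ shift i S → Σ ℕ λ y → x ≡ i + y × y ∈ᴺ S
shift⁻ zero    p = _ , refl , p
shift⁻ (suc i) (there p) with shift⁻ i p
... | y , refl , q = y , refl , q

unshift : ∀ {m} i → Subset (i + m) → Subset m
unshift zero    T       = T
unshift (suc i) (_ ∷ T) = unshift i T

unshift⁺ : ∀ {m} i (T : Subset (i + m)) {y} → (i + y) ∈ᴺ T → y ∈ᴺ unshift i T
unshift⁺ zero    T       p         = p
unshift⁺ (suc i) (_ ∷ T) (there p) = unshift⁺ i T p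

unshift⁻ : ∀ {m} i (T : Subset (i + m)) {y} → y ∈ᴺ unshift i T → (i + y) ∈ᴺ T
unshift⁻ zero    T       p = p
unshift⁻ (suc i) (_ ∷ T) p = there (unshift⁻ i T p)

∪₀-zero : ∀ {n} (T : Subset (suc n)) → zero ∈ᴺ (⁅ zero ⁆ ∪ T)
∪₀-zero (_ ∷ _) = here

∪₀⁺ : ∀ {n} (T : Subset (suc n)) {x} → x ∈ᴺ T → x ∈ᴺ (⁅ zero ⁆ ∪ T)
∪₀⁺ (_ ∷ T) here = here
∪₀⁺ (_ ∷ T) {suc x} (there p) = there (subst (x ∈ᴺ_) (sym (∪-identityˡ T)) p)

∪₀⁻ : ∀ {n} (T : Subset (suc n)) {x} → x ∈ᴺ (⁅ zero ⁆ ∪ T) → x ≡ 0 ⊎ x ∈ᴺ T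
∪₀⁻ (_ ∷ T) here = inj₁ refl
∪₀⁻ (_ ∷ T) {suc x} (there p) = inj₂ (there (subst (x ∈ᴺ_) (∪-identityˡ T) p))

module _ {r m : ℕ} (k : Fin r) (S : Tuple r m) where
  private
    i : ℕ
    i = suc (toℕ k)

  φ-entry-at : lookup (φ k S) k ≡ ⁅ zero ⁆ ∪ shift i (lookup S k)
  φ-entry-at = trans (lookup∘updateAt k (map (shift i) S)) (cong (⁅ zero ⁆ ∪_) (lookup-map k _ S))

  φ-entry-off : ∀ l → l ≢ k → lookup (φ k S) l ≡ shift i (lookup S l)
  φ-entry-off l l≢k = trans (lookup∘updateAt′ l k l≢k (map (shift i) S)) (lookup-map l _ S)

  φ-zero : zero ∈ᴺ lookup (φ k S) k
  φ-zero = subst (zero ∈ᴺ_) (sym φ-entry-at) (∪₀-zero (shift i (lookup S k)))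

  φ⁺ : ∀ l {y} → y ∈ᴺ lookup S l → (i + y) ∈ᴺ lookup (φ k S) l
  φ⁺ l {y} p with l Fin.≟ k
  ... | yes refl = subst ((i + y) ∈ᴺ_) (sym φ-entry-at) (∪₀⁺ _ (shift⁺ i p))
  ... | no l≢k   = subst ((i + y) ∈ᴺ_) (sym (φ-entry-off l l≢k)) (shift⁺ i p)

  φ⁻ : ∀ l {x} → x ∈ᴺ lookup (φ k S) l →
       (l ≡ k × x ≡ 0) ⊎ Σ ℕ λ y → x ≡ i + y × y ∈ᴺ lookup S l
  φ⁻ l {x} p with l Fin.≟ k
  ... | no l≢k = inj₂ (shift⁻ i (subst (x ∈ᴺ_) (φ-entry-off l l≢k) p))
  ... | yes refl with ∪₀⁻ _ (subst (x ∈ᴺ_) φ-entry-at p)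
  ...   | inj₁ x≡0 = inj₁ (refl , x≡0)
  ...   | inj₂ q   = inj₂ (shift⁻ i q)

-- φ_i is injective: S_l is recovered from the l-th entry of φ_i(S) by unshifting.
φ-injective : ∀ {r m} (k : Fin r) (S S' : Tuple r m) → φ k S ≡ φ k S' → S ≡ S'
φ-injective {r} {m} k S S' eq =
  tuple-ext S S' λ l → subset-ext _ _ (transfer S S' eq l) (transfer S' S (sym eq) l)
  where
  transfer : ∀ (U V : Tuple r m) → φ k U ≡ φ k V → ∀ l y → y ∈ᴺ lookup U l → y ∈ᴺ lookup V l
  transfer U V eq l y p with φ⁻ k V l (subst (λ W → (suc (toℕ k) + y) ∈ᴺ lookup W l) eq (φ⁺ k U l p))
  ... | inj₁ (_ , ())
  ... | inj₂ (y' , e , q) = subst (_∈ᴺ lookup V l) (sym (+-cancelˡ-≡ (suc (toℕ k)) _ _ e)) q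

-- A number j ≤ a is never of the form (a + 1 + y) + j'; this separates the copies
-- 0 + j (j < i) of the new point from the blocks shifted by i.
small-shift≢large : ∀ {a j y j'} → j ≤ a → j ≢ suc a + y + j'
small-shift≢large {a} {j} {y} {j'} j≤a e =
  1+n≰n (≤-trans (≤-trans (m≤m+n (suc a) y) (m≤m+n (suc a + y) j')) (≤-trans (≤-reflexive (sym e)) j≤a))

-- Part (i), disjointness: 0 lies in S_k + 0 and in S_k' + 0, two distinct blocks.
partAt-disjoint : ∀ {r n} (k k' : Fin r) → k ≢ k' → (S : Tuple r n) →
                  IsPartAt r n k S → IsPartAt r n k' S → ⊥
partAt-disjoint k k' k≢k' S (P , 0∈Sk) (_ , 0∈Sk') =
  IsPart.disjoint P k k' 0 0 z≤n z≤n (λ e → k≢k' (cong proj₁ e)) 0 (0 , 0∈Sk , refl) (0 , 0∈Sk' , refl)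

-- Part (i), covering: the block covering 0 must be some S_k + 0 with 0 ∈ S_k.
partAt-exists : ∀ {r n} → 1 ≤ n → (S : Tuple r n) → IsPart r n S → Σ (Fin r) λ k → IsPartAt r n k S
partAt-exists (s≤s z≤n) S P with to (IsPart.union P 0) z<s
... | k , zero , _ , zero , 0∈Sk , refl = k , P , 0∈Sk

-- If 0 ∈ T_k then the blocks T_k + 0, …, T_k + toℕ k cover {0,…,toℕ k}; hence
-- these points lie in no other block, in particular x ∈ T_l with x ≤ toℕ k forces (l,x) = (k,0).
initial-segment : ∀ {r n} (k : Fin r) (T : Tuple r n) → IsPartAt r n k T →
                  ∀ l x → x ∈ᴺ lookup T l → x ≤ toℕ k → l ≡ k × x ≡ 0
initial-segment k T (P , 0∈Tk) l x x∈Tl x≤k with ≡-dec Fin._≟_ _≟_ (l , x) (k , 0)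
... | yes refl = refl , refl
... | no lx≢k0  =
  ⊥-elim (IsPart.disjoint P l k 0 x z≤n x≤k
           (λ e → lx≢k0 (cong₂ _,_ (cong proj₁ e) (sym (cong proj₂ e))))
           x (x , x∈Tl , sym (+-identityʳ x)) (0 , 0∈Tk , refl))

-- P^i_r(n) is empty when n < i: the block T_k + toℕ k would contain toℕ k ≥ n.
partAt-too-short : ∀ {r n} (k : Fin r) → n < suc (toℕ k) → (T : Tuple r n) → IsPartAt r n k T → ⊥
partAt-too-short k n≤k T (P , 0∈Tk) =
  1+n≰n (≤-trans (from (IsPart.union P (toℕ k)) (k , toℕ k , ≤-refl , 0 , 0∈Tk , refl)) (≤-pred n≤k))

-- Covered points of φ_i(S) are the point 0 (covered i times, by the new
-- element of the i-th entry) and the shifts by i of points covered by S.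
module _ {r m : ℕ} (k : Fin r) (S : Tuple r m) (P : IsPart r m S) where
  private
    i : ℕ
    i = suc (toℕ k)
    open IsPart P

  φ-IsPart : IsPart r (i + m) (φ k S)
  IsPart.disjoint φ-IsPart l l' j j' j≤l j'≤l' ne x (s , s∈ , e) (s' , s'∈ , e')
    with φ⁻ k S l s∈ | φ⁻ k S l' s'∈
  ... | inj₁ (refl , refl) | inj₁ (refl , refl) = ne (cong (k ,_) (trans (sym e) e'))
  ... | inj₁ (refl , refl) | inj₂ (_ , refl , _) = small-shift≢large j≤l (trans (sym e) e')
  ... | inj₂ (_ , refl , _) | inj₁ (refl , refl) = small-shift≢large j'≤l' (trans (sym e') e)
  ... | inj₂ (y , refl , y∈) | inj₂ (y' , refl , y'∈) =
    disjoint l l' j j' j≤l j'≤l' ne (y + j) (y , y∈ , refl) (y' , y'∈ , y+j≡y'+j')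
    where
    y+j≡y'+j' : y + j ≡ y' + j'
    y+j≡y'+j' = +-cancelˡ-≡ i _ _ (begin
      i + (y + j)   ≡⟨ +-assoc i y j ⟨
      i + y + j     ≡⟨ trans (sym e) e' ⟩
      i + y' + j'   ≡⟨ +-assoc i y' j' ⟩
      i + (y' + j') ∎)
      where open ≡-Reasoning
  IsPart.union φ-IsPart x = mk⇔ covered bounded
    where
    covered : x < i + m → Σ (Fin r) λ l → Σ ℕ λ j → j ≤ toℕ l × x ∈ lookup (φ k S) l + j
    covered x< with below-or-shifted i x
    ... | inj₁ x<i = k , x , ≤-pred x<i , 0 , φ-zero k S , refl
    ... | inj₂ (y , refl) with to (union y) (+-cancelˡ-< i _ _ x<)
    ...   | l , j , j≤l , s , s∈ , refl = l , j , j≤l , i + s , φ⁺ k S l s∈ , sym (+-assoc i s j)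
    bounded : (Σ (Fin r) λ l → Σ ℕ λ j → j ≤ toℕ l × x ∈ lookup (φ k S) l + j) → x < i + m
    bounded (l , j , j≤l , s , s∈ , refl) with φ⁻ k S l s∈
    ... | inj₁ (refl , refl) = ≤-trans (s≤s j≤l) (m≤m+n i m)
    ... | inj₂ (y , refl , y∈) =
      subst (_< i + m) (sym (+-assoc i y j)) (+-monoʳ-< i (from (union (y + j)) (l , j , j≤l , y , y∈ , refl)))

  φ-IsPartAt : IsPartAt r (i + m) k (φ k S)
  φ-IsPartAt = φ-IsPart , φ-zero k S

-- Part (ii), surjectivity: T ∈ P^i_r(i + m) is φ_i of its unshift.  By
-- 'initial-segment' T has nothing below i except 0 ∈ T_k, so nothing is lost.
module _ {r m : ℕ} (k : Fin r) (T : Tuple r (suc (toℕ k) + m))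
         (PT : IsPartAt r (suc (toℕ k) + m) k T) where
  private
    i : ℕ
    i = suc (toℕ k)
    open IsPart (proj₁ PT)

  unshiftTuple : Tuple r m
  unshiftTuple = map (unshift i) T

  private
    S = unshiftTuple

    S⁺ : ∀ l {y} → (i + y) ∈ᴺ lookup T l → y ∈ᴺ lookup S l
    S⁺ l {y} p = subst (y ∈ᴺ_) (sym (lookup-map l (unshift i) T)) (unshift⁺ i (lookup T l) p)

    S⁻ : ∀ l {y} → y ∈ᴺ lookup S l → (i + y) ∈ᴺ lookup T l
    S⁻ l {y} p = unshift⁻ i (lookup T l) (subst (y ∈ᴺ_) (lookup-map l (unshift i) T) p)

    S-block⁻ : ∀ l j y → y ∈ lookup S l + j → (i + y) ∈ lookup T l + j
    S-block⁻ l j y (s , s∈ , refl) = i + s , S⁻ l s∈ , sym (+-assoc i s j)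

  unshift-IsPart : IsPart r m S
  IsPart.disjoint unshift-IsPart l l' j j' j≤l j'≤l' ne y p p' =
    disjoint l l' j j' j≤l j'≤l' ne (i + y) (S-block⁻ l j y p) (S-block⁻ l' j' y p')
  IsPart.union unshift-IsPart y = mk⇔ covered bounded
    where
    covered : y < m → Σ (Fin r) λ l → Σ ℕ λ j → j ≤ toℕ l × y ∈ lookup S l + j
    covered y< with to (union (i + y)) (+-monoʳ-< i y<)
    ... | l , j , j≤l , s , s∈ , e with below-or-shifted i s
    ...   | inj₁ s<i with initial-segment k T PT l s s∈ (≤-pred s<i)
    ...     | refl , refl = ⊥-elim (small-shift≢large {y = y} {j' = 0} j≤l (trans (sym e) (sym (+-identityʳ (i + y)))))
    covered y< | l , j , j≤l , _ , s∈ , e | inj₂ (s , refl) =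
      l , j , j≤l , s , S⁺ l s∈ , +-cancelˡ-≡ i _ _ (trans e (+-assoc i s j))
    bounded : (Σ (Fin r) λ l → Σ ℕ λ j → j ≤ toℕ l × y ∈ lookup S l + j) → y < m
    bounded (l , j , j≤l , p) = +-cancelˡ-< i _ _ (from (union (i + y)) (l , j , j≤l , S-block⁻ l j y p))

  φ-unshift : φ k S ≡ T
  φ-unshift = tuple-ext _ _ λ l → subset-ext _ _ (φS⊆T l) (T⊆φS l)
    where
    φS⊆T : ∀ l x → x ∈ᴺ lookup (φ k S) l → x ∈ᴺ lookup T l
    φS⊆T l x p with φ⁻ k S l p
    ... | inj₁ (refl , refl) = proj₂ PT
    ... | inj₂ (y , refl , q) = S⁻ l q
    T⊆φS : ∀ l x → x ∈ᴺ lookup T l → x ∈ᴺ lookup (φ k S) l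
    T⊆φS l x p with below-or-shifted i x
    ... | inj₂ (y , refl) = φ⁺ k S l (S⁺ l p)
    ... | inj₁ x<i with initial-segment k T PT l x p (≤-pred x<i)
    ...   | refl , refl = φ-zero k S

HasCard-⇔ : ∀ {A : Set} {P Q : A → Set} {c} → (∀ a → P a ⇔ Q a) → HasCard P c → HasCard Q c
HasCard-⇔ P⇔Q (L , uniq , mem , len) =
  L , uniq , (λ a → mk⇔ (λ x → to (P⇔Q a) (to (mem a) x)) (λ y → from (mem a) (from (P⇔Q a) y))) , len

HasCard-empty : ∀ {A : Set} {P : A → Set} → (∀ a → ¬ P a) → HasCard P 0
HasCard-empty ¬P = [] , [] , (λ a → mk⇔ (λ ()) (λ p → ⊥-elim (¬P a p))) , refl

HasCard-singleton : ∀ {A : Set} {P : A → Set} (a₀ : A) → (∀ a → P a ⇔ a ≡ a₀) → HasCard P 1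
HasCard-singleton a₀ P⇔≡ =
  a₀ ∷ [] , [] ∷ [] , (λ a → mk⇔ (λ { (here refl) → from (P⇔≡ a₀) refl }) (λ p → here (to (P⇔≡ a) p))) , refl

HasCard-⊎ : ∀ {A : Set} {P Q : A → Set} {a b} → (∀ x → P x → Q x → ⊥) →
            HasCard P a → HasCard Q b → HasCard (λ x → P x ⊎ Q x) (a + b)
HasCard-⊎ disj (L , u , mem , refl) (L' , u' , mem' , refl) =
  L ++ L' , ++⁺ u u' (λ {v} (p , q) → disj v (to (mem v) p) (to (mem' v) q)) ,
  (λ a → mk⇔ (Sum.map (to (mem a)) (to (mem' a)) ∘ ∈-++⁻ L)
             (Sum.[ ∈-++⁺ˡ ∘ from (mem a) , ∈-++⁺ʳ L ∘ from (mem' a) ])) ,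
  length-++ L

HasCard-Σ : ∀ {A : Set} r (P : Fin r → A → Set) (c : Fin r → ℕ) →
            (∀ k k' → k ≢ k' → ∀ a → P k a → P k' a → ⊥) → (∀ k → HasCard (P k) (c k)) →
            HasCard (λ a → Σ (Fin r) λ k → P k a) (sum (tabulate c))
HasCard-Σ zero P c _ _ = HasCard-empty (λ { _ (() , _) })
HasCard-Σ (suc r) P c disj card =
  HasCard-⇔ split (HasCard-⊎ (λ a p (k , q) → disj zero (suc k) (λ ()) a p q) (card zero)
    (HasCard-Σ r (λ k → P (suc k)) (λ k → c (suc k))
      (λ k k' ne → disj (suc k) (suc k') (λ e → ne (suc-injective e))) (λ k → card (suc k))))
  where
  split : ∀ a → (P zero a ⊎ Σ (Fin r) λ k → P (suc k) a) ⇔ (Σ (Fin (suc r)) λ k → P k a)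
  split a = mk⇔ (λ { (inj₁ p) → zero , p ; (inj₂ (k , q)) → suc k , q })
                (λ { (zero , p) → inj₁ p ; (suc k , q) → inj₂ (k , q) })

HasCard-image : ∀ {A B : Set} {P : A → Set} {Q : B → Set} {c} (f : A → B) →
                (∀ {a a'} → f a ≡ f a' → a ≡ a') → (∀ a → P a → Q (f a)) →
                (∀ b → Q b → Σ A λ a → P a × f a ≡ b) → HasCard P c → HasCard Q c
HasCard-image {Q = Q} f f-inj P→Q onto (L , u , mem , len) =
  mapₗ f L , map⁺ f-inj u , (λ b → mk⇔ (inImage b) (imageOf b)) , trans (length-map f L) len
  where
  inImage : ∀ b → b ∈ₗ mapₗ f L → Q b
  inImage b p with ∈-map⁻ f p
  ... | a , a∈L , refl = P→Q a (to (mem a) a∈L)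
  imageOf : ∀ b → Q b → b ∈ₗ mapₗ f L
  imageOf b q with onto b q
  ... | a , pa , refl = ∈-map⁺ f (from (mem a) pa)

nth₀ : List ℕ → ℕ → ℕ
nth₀ []       _       = 0
nth₀ (x ∷ _)  zero    = x
nth₀ (_ ∷ xs) (suc j) = nth₀ xs j

nth₀-fibList : ∀ r n j → j ≤ n → nth₀ (fibList r n) j ≡ fib r (n ∸ j)
nth₀-fibList r zero    zero    _         = refl
nth₀-fibList r (suc n) zero    _         = refl
nth₀-fibList r (suc n) (suc j) (s≤s j≤n) = nth₀-fibList r n j j≤n

nth₀-fibList-beyond : ∀ r n j → n < j → nth₀ (fibList r n) j ≡ 0
nth₀-fibList-beyond r zero    (suc j) _         = refl
nth₀-fibList-beyond r (suc n) (suc j) (s≤s n<j) = nth₀-fibList-beyond r n j n<j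

-- The sum of the first r entries, written as a sum over Fin r (the form 'HasCard-Σ' produces).
sum-take : ∀ r xs → sum (tabulate {n = r} (λ k → nth₀ xs (toℕ k))) ≡ sum (take r xs)
sum-take zero    xs       = refl
sum-take (suc r) []       = trans (sum-take r []) (cong sum (take-[] r))
sum-take (suc r) (x ∷ xs) = cong (x +_) (sum-take r xs)

card-P-zero : ∀ r → HasCard (IsPart r 0) (fib r 0)
card-P-zero r = HasCard-singleton (replicate r []) λ S → mk⇔ (λ _ → all-empty S) (λ _ → partitions-∅ S)
  where
  nothing∈ : ∀ {x} (V : Subset 0) → ¬ (x ∈ᴺ V)
  nothing∈ [] ()
  all-empty : ∀ {r} (S : Tuple r 0) → S ≡ replicate r []
  all-empty []       = refl
  all-empty ([] ∷ S) = cong ([] ∷_) (all-empty S)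
  partitions-∅ : (S : Tuple r 0) → IsPart r 0 S
  IsPart.disjoint (partitions-∅ S) k _ _ _ _ _ _ _ (_ , s∈ , _) _ = nothing∈ (lookup S k) s∈
  IsPart.union (partitions-∅ S) _ =
    mk⇔ (λ ()) (λ { (k , _ , _ , _ , s∈ , _) → ⊥-elim (nothing∈ (lookup S k) s∈) })

-- |P^i_r(n+1)| is the (i-1)-th entry of fibList r n, i.e. F_{n+1-i} (0 if i > n+1):
-- by (ii) when i ≤ n + 1, and because P^i_r(n+1) is empty otherwise.
card-P-at : ∀ r n → (∀ {m} → m < suc n → HasCard (IsPart r m) (fib r m)) →
            ∀ k → HasCard (IsPartAt r (suc n) k) (nth₀ (fibList r n) (toℕ k))
card-P-at r n IH k with toℕ k ≤? n
... | no k≰n =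
  subst (HasCard _) (sym (nth₀-fibList-beyond r n (toℕ k) (≰⇒> k≰n)))
    (HasCard-empty (partAt-too-short k (s≤s (≰⇒> k≰n))))
... | yes k≤n =
  subst₂ (λ N c → HasCard (IsPartAt r N k) c) (cong suc (m+[n∸m]≡n k≤n)) (sym (nth₀-fibList r n (toℕ k) k≤n))
    (HasCard-image {Q = IsPartAt r (suc (toℕ k) + (n ∸ toℕ k)) k} (φ k) (φ-injective k _ _) (φ-IsPartAt k)
      (λ T PT → unshiftTuple k T PT , unshift-IsPart k T PT , φ-unshift k T PT)
      (IH (s≤s (m∸n≤m n (toℕ k)))))

-- Part (iii) for n ∈ ℕ, by strong induction: |P_r(n+1)| = Σ_i |P^i_r(n+1)| by (i).
card-P : ∀ r n → HasCard (IsPart r n) (fib r n)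
card-P r = <-rec (λ n → HasCard (IsPart r n) (fib r n)) step
  where
  step : ∀ n → (∀ {m} → m < n → HasCard (IsPart r m) (fib r m)) → HasCard (IsPart r n) (fib r n)
  step zero    _  = card-P-zero r
  step (suc n) IH =
    subst (HasCard _) (sum-take r (fibList r n))
      (HasCard-⇔ (λ S → mk⇔ (λ (_ , P , _) → P) (partAt-exists (s≤s z≤n) S))
        (HasCard-Σ r (λ k → IsPartAt r (suc n) k) _ (λ k k' k≢k' S → partAt-disjoint k k' k≢k' S)
          (card-P-at r n IH)))

card-P-ℤ : ∀ r (n : ℤ) → HasCard (IsPartZ r n) (fibZ r n)
card-P-ℤ r (pos n)  = card-P r n
card-P-ℤ r -[1+ n ] = HasCard-empty (λ ())

lemma2p1 : (r : ℕ) → 1 ≤ r →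
    ((n : ℕ) → 1 ≤ n →
    ((k k' : Fin r) → k ≢ k' → (S : Tuple r n) → IsPartAt r n k S → IsPartAt r n k' S → ⊥)
    × ((S : Tuple r n) → IsPart r n S → Σ (Fin r) λ k → IsPartAt r n k S))
    × ((k : Fin r) →
    ((m : ℕ) →
    ((S : Tuple r m) → IsPart r m S → IsPartAt r (suc (toℕ k) + m) k (φ k S))
    × ((S S' : Tuple r m) → IsPart r m S → IsPart r m S' → φ k S ≡ φ k S' → S ≡ S')
    × ((T : Tuple r (suc (toℕ k) + m)) → IsPartAt r (suc (toℕ k) + m) k T →
    Σ (Tuple r m) λ S → IsPart r m S × φ k S ≡ T))
    × ((n : ℕ) → 1 ≤ n → n < suc (toℕ k) → (T : Tuple r n) → IsPartAt r n k T → ⊥))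
    × ((n : ℤ) → HasCard (IsPartZ r n) (fibZ r n))
lemma2p1 r _ =
  (λ n 1≤n → partAt-disjoint , partAt-exists 1≤n) ,
  (λ k → (λ m → φ-IsPartAt k ,
                (λ S S' _ _ → φ-injective k S S') ,
                (λ T PT → unshiftTuple k T PT , unshift-IsPart k T PT , φ-unshift k T PT)) ,
         (λ n _ → partAt-too-short k)) ,
  card-P-ℤ r
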